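{- Let $q\ge 2$ and let $A$ be an alphabet with $q$ letters. There is a constant $c>1$ such that for every rich word $w$ over $A$ of length $n\ge 2$, the number $p$ of palindromes in the UPS-factorization $w=w_pw_{p-1}\cdots w_2w_1$ of $w$ satisfies $p\le c\,\frac{n}{\ln n}$.
   Context: A finite word $u=u_1\cdots u_n$ is a palindrome if $u_1u_2\cdots u_n=u_nu_{n-1}\cdots u_1$; the empty word is a palindrome. A word $w$ of length $n$ is rich if it has exactly $n+1$ distinct palindromic factors (including the empty word). For a rich word $w$, its UPS-factorization (Unioccurrent Palindromic Suffix factorization) is the factorization $w=w_pw_{p-1}\cdots w_2w_1$ into non-empty palindromes $w_1,\dots,w_p$ such that, for each $i=1,\dots,p$, $w_i$ is the longest palindromic suffix of $w_pw_{p-1}\cdots w_i$; such a factorization exists for every rich word, and its palindromes $w_1,\dots,w_p$ are pairwise distinct. -}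

module Defs where

open import Data.Nat using (ℕ; suc)
open import Data.Fin using (Fin)
open import Data.Fin.Properties using () renaming (_≟_ to _≟ᶠ_)
open import Data.List using (List; []; _∷_; _++_; reverse; length; tails; inits; concatMap; filter; deduplicate)
open import Data.List.Properties using (≡-dec)
open import Data.Product using (∃; _×_)
open import Data.Nat using (_≤_)
open import Relation.Binary.PropositionalEquality using (_≡_; _≢_)
open import Relation.Binary.Definitions using (DecidableEquality)
open import Relation.Nullary using (Dec)

Word : ℕ → Set
Word q = List (Fin q)

_≟w_ : ∀ {q} → DecidableEquality (Word q)
_≟w_ = ≡-dec _≟ᶠ_

IsPalindrome : ∀ {q} → Word q → Set
IsPalindrome u = reverse u ≡ u

isPalindrome? : ∀ {q} (u : Word q) → Dec (IsPalindrome u)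
isPalindrome? u = reverse u ≟w u

factors : ∀ {q} → Word q → List (Word q)
factors w = concatMap inits (tails w)

-- the list of distinct palindromic factors of w (including the empty word)
palFactors : ∀ {q} → Word q → List (Word q)
palFactors w = deduplicate _≟w_ (filter isPalindrome? (factors w))

Rich : ∀ {q} → Word q → Set
Rich w = length (palFactors w) ≡ suc (length w)

IsSuffix : ∀ {q} → Word q → Word q → Set
IsSuffix s x = ∃ λ t → t ++ s ≡ x

IsLPS : ∀ {q} → Word q → Word q → Set
IsLPS u x = IsPalindrome u × IsSuffix u x
          × (∀ s → IsPalindrome s → IsSuffix s x → length s ≤ length u)

-- UPS w ws : ws = w₁ ∷ w₂ ∷ … ∷ w_p (listed from the right end of w) is the
-- UPS-factorization of w = w_p ⋯ w₂ w₁, i.e. each w_i is non-empty and is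
-- the longest palindromic suffix of w_p ⋯ w_i.
data UPS {q : ℕ} : Word q → List (Word q) → Set where
  ups-[] : UPS [] []
  ups-∷  : ∀ {v u us} → u ≢ [] → IsLPS u (v ++ u) → UPS v us → UPS (v ++ u) (u ∷ us)

{-# OPTIONS --safe #-}

-- Appending a letter to a word creates at most one new palindrome: a new palindrome is a
-- palindromic suffix, and of two palindromic suffixes the shorter one is, by reflection,
-- also a prefix of the longer one, so unless they are equal it occurred before. Hence in a
-- rich word, all of whose prefixes are rich, the longest palindromic suffix of every prefix
-- is new, and the p palindromes of the UPS-factorization of w are pairwise distinct; their
-- lengths add up to n = |w|. Distinct words over q letters of total length n satisfy
-- p! ≤ (q+1)^n: if the longest of them has length ℓ, all p of them are among the at most
-- (q+1)^ℓ words of length ≤ ℓ, and the rest is handled by induction. Together with p ≤ n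
-- and n^p ≤ p!·2^(n+p) this gives n^p ≤ (q+1)^n·4^n ≤ 3^((q+2)n),
-- i.e. p ln n ≤ (q+2) ln 3 · n.

module Submission where

open import Defs
open import Data.List
  using (List; []; _∷_; _++_; [_]; _∷ʳ_; reverse; length; map; filter; inits; tails; allFin;
         cartesianProductWith)
open import Data.List.Extrema.Nat using (argmax; argmax-all; f[⊥]≤f[argmax]; f[xs]≤f[argmax])
open import Data.List.Membership.Propositional using (_∈_; _∉_; lose; find)
open import Data.List.Membership.Propositional.Properties
  using (∈-++⁻; ∈-++⁺ˡ; ∈-++⁺ʳ; ∈-∃++; ∈-allFin; ∈-map⁺; ∈-map⁻; ∈-concatMap⁺; ∈-concatMap⁻;
         ∈-filter⁺; ∈-filter⁻; ∈-deduplicate⁺; ∈-deduplicate⁻)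
open import Data.List.Properties
  using (++-assoc; ++-identityʳ; length-++; length-++-≤ˡ; length-++-≤ʳ; length-++-sucʳ; length-map;
         length-tabulate; reverse-++; ∷ʳ-injectiveˡ; ∷ʳ-++; ∷-injectiveʳ)
open import Data.List.Relation.Binary.Subset.Propositional using (_⊆_)
open import Data.List.Relation.Unary.All as All using (All; _∷_)
open import Data.List.Relation.Unary.All.Properties as All using ()
open import Data.List.Relation.Unary.AllPairs using ([]; _∷_)
open import Data.List.Relation.Unary.Any using (here; there; any?)
open import Data.List.Relation.Unary.Any.Properties using (cartesianProductWith⁺)
open import Data.List.Relation.Unary.Unique.Propositional using (Unique)
open import Data.List.Relation.Unary.Unique.DecPropositional.Properties using (deduplicate-!)
open import Data.List.Reverse using (reverseView; []; _∶_∶ʳ_)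
open import Data.Nat using (ℕ; zero; suc; _+_; _*_; _^_; _!; _≤_; _<_; z≤n; s≤s)
open import Data.Nat.ListAction using (sum)
open import Data.Nat.Properties
open import Algebra.Properties.CommutativeSemigroup +-commutativeSemigroup using (x∙yz≈y∙xz)
open import Data.Nat.Tactic.RingSolver using (solve-∀)
open import Data.Product using (∃; ∃₂; ∃-syntax; _×_; _,_)
open import Data.Sum using (_⊎_; inj₁; inj₂)
open import Relation.Binary.PropositionalEquality
  using (_≡_; _≢_; refl; sym; trans; cong; cong₂; subst; module ≡-Reasoning)
open import Relation.Nullary using (¬_; yes; no; contradiction)
open import Relation.Nullary.Decidable using (¬?; decidable-stable)

module _ {A : Set} where

  ∈-++-∷⁻ : ∀ {a z : A} xs {ys} → z ∈ xs ++ a ∷ ys → a ≢ z → z ∈ xs ++ ys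
  ∈-++-∷⁻ xs z∈ a≢z with ∈-++⁻ xs z∈
  ... | inj₁ z∈xs         = ∈-++⁺ˡ z∈xs
  ... | inj₂ (here refl)  = contradiction refl a≢z
  ... | inj₂ (there z∈ys) = ∈-++⁺ʳ xs z∈ys

  Unique-length-≤ : ∀ {xs ys : List A} → Unique xs → xs ⊆ ys → length xs ≤ length ys
  Unique-length-≤ {[]}     _            _     = z≤n
  Unique-length-≤ {x ∷ xs} (x∉xs ∷ xs!) xs⊆ys with ∈-∃++ (xs⊆ys (here refl))
  ... | ys₁ , ys₂ , refl = begin
    suc (length xs)           ≤⟨ s≤s (Unique-length-≤ xs! xs⊆ys₁++ys₂) ⟩
    suc (length (ys₁ ++ ys₂)) ≡⟨ length-++-sucʳ ys₁ x ys₂ ⟨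
    length (ys₁ ++ x ∷ ys₂)   ∎
    where
      open ≤-Reasoning
      xs⊆ys₁++ys₂ : xs ⊆ ys₁ ++ ys₂
      xs⊆ys₁++ys₂ z∈ = ∈-++-∷⁻ ys₁ (xs⊆ys (there z∈)) (All.lookup x∉xs z∈)

  All-delete : ∀ {P : A → Set} {m} xs {ys} → All P (xs ++ m ∷ ys) → All P (xs ++ ys)
  All-delete xs ps = All.++⁺ (All.++⁻ˡ xs ps) (All.tail (All.++⁻ʳ xs ps))

  Unique-delete : ∀ {m : A} xs {ys} → Unique (xs ++ m ∷ ys) → Unique (xs ++ ys)
  Unique-delete []       (_ ∷ ys!)     = ys!
  Unique-delete (x ∷ xs) (x∉ ∷ rest!) = All-delete xs x∉ ∷ Unique-delete xs rest!

  sum-map-++-∷ : ∀ (f : A → ℕ) xs m ys →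
                 sum (map f (xs ++ m ∷ ys)) ≡ f m + sum (map f (xs ++ ys))
  sum-map-++-∷ f []       m ys = refl
  sum-map-++-∷ f (x ∷ xs) m ys =
    trans (cong (f x +_) (sum-map-++-∷ f xs m ys)) (x∙yz≈y∙xz (f x) (f m) _)

  longest-split : (f : A → ℕ) (ws : List A) → ws ≢ [] →
                  ∃[ m ] ∃₂ λ xs ys → ws ≡ xs ++ m ∷ ys × All (λ v → f v ≤ f m) ws
  longest-split f []       ws≢[] = contradiction refl ws≢[]
  longest-split f (w ∷ ws) _     with ∈-∃++ longest∈
    where
      longest∈ : argmax f w ws ∈ w ∷ ws
      longest∈ = argmax-all f (here refl) (All.tabulate there)
  ... | xs , ys , eq =
    argmax f w ws , xs , ys , eq , f[⊥]≤f[argmax] {f = f} w ws ∷ f[xs]≤f[argmax] {f = f} w ws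

-- Palindromic factors and rich words

module _ {q : ℕ} where

  private
    W = Word q

  open import Data.List.Membership.DecPropositional (_≟w_ {q}) using (_∈?_)

  IsPrefix : W → W → Set
  IsPrefix s x = ∃ λ t → s ++ t ≡ x

  IsFactor : W → W → Set
  IsFactor z x = ∃₂ λ a b → a ++ z ++ b ≡ x

  ∈-inits⁻ : ∀ {z} (y : W) → z ∈ inits y → IsPrefix z y
  ∈-inits⁻ []      (here refl) = [] , refl
  ∈-inits⁻ (x ∷ y) (here refl) = x ∷ y , refl
  ∈-inits⁻ (x ∷ y) (there z∈) with ∈-map⁻ (x ∷_) z∈
  ... | z , z∈′ , refl with ∈-inits⁻ y z∈′
  ... | t , refl = t , refl

  ∈-inits⁺ : ∀ (z t : W) → z ∈ inits (z ++ t)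
  ∈-inits⁺ []      t = here refl
  ∈-inits⁺ (x ∷ z) t = there (∈-map⁺ (x ∷_) (∈-inits⁺ z t))

  ∈-tails⁻ : ∀ {z} (y : W) → z ∈ tails y → IsSuffix z y
  ∈-tails⁻ []      (here refl) = [] , refl
  ∈-tails⁻ (x ∷ y) (here refl) = [] , refl
  ∈-tails⁻ (x ∷ y) (there z∈) with ∈-tails⁻ y z∈
  ... | t , refl = x ∷ t , refl

  ∈-tails⁺ : ∀ (t z : W) → z ∈ tails (t ++ z)
  ∈-tails⁺ []      []      = here refl
  ∈-tails⁺ []      (x ∷ z) = here refl
  ∈-tails⁺ (x ∷ t) z       = there (∈-tails⁺ t z)

  ∈-factors⁻ : ∀ {z} (x : W) → z ∈ factors x → IsFactor z x
  ∈-factors⁻ x z∈ with find (∈-concatMap⁻ inits {xs = tails x} z∈)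
  ... | y , y∈ , z∈inits with ∈-tails⁻ x y∈ | ∈-inits⁻ y z∈inits
  ... | a , refl | b , refl = a , b , refl

  ∈-factors⁺ : ∀ {z x} → IsFactor z x → z ∈ factors x
  ∈-factors⁺ {z} (a , b , refl) = ∈-concatMap⁺ inits (lose (∈-tails⁺ a (z ++ b)) (∈-inits⁺ z b))

  ∈-palFactors⁻ : ∀ {z} (x : W) → z ∈ palFactors x → IsPalindrome z × IsFactor z x
  ∈-palFactors⁻ x z∈ with ∈-filter⁻ isPalindrome? (∈-deduplicate⁻ _≟w_ _ z∈)
  ... | z∈factors , z-pal = z-pal , ∈-factors⁻ x z∈factors

  ∈-palFactors⁺ : ∀ {z x} → IsPalindrome z → IsFactor z x → z ∈ palFactors x
  ∈-palFactors⁺ z-pal z-fac =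
    ∈-deduplicate⁺ _≟w_ (∈-filter⁺ isPalindrome? (∈-factors⁺ z-fac) z-pal)

  palFactors-Unique : ∀ (x : W) → Unique (palFactors x)
  palFactors-Unique x = deduplicate-! _≟w_ (filter isPalindrome? (factors x))

  IsFactor-++ʳ : ∀ {z v : W} u → IsFactor z v → IsFactor z (v ++ u)
  IsFactor-++ʳ {z} u (a , b , refl) =
    a , b ++ u , sym (trans (++-assoc a (z ++ b) u) (cong (a ++_) (++-assoc z b u)))

  ++-∷ʳ-injectiveˡ : ∀ (t v : W) {c a} x → t ++ v ∷ʳ c ≡ x ∷ʳ a → t ++ v ≡ x
  ++-∷ʳ-injectiveˡ t v {c} x eq = ∷ʳ-injectiveˡ (t ++ v) x (trans (++-assoc t v [ c ]) eq)

  IsFactor-∷ʳ⁻ : ∀ {z x : W} {a} → IsFactor z (x ∷ʳ a) → IsFactor z x ⊎ IsSuffix z (x ∷ʳ a)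
  IsFactor-∷ʳ⁻ {z} {x} (t , b , eq) with reverseView b
  ... | []           = inj₂ (t , trans (cong (t ++_) (sym (++-identityʳ z))) eq)
  ... | b′ ∶ _ ∶ʳ c =
    inj₁ (t , b′ , ++-∷ʳ-injectiveˡ t (z ++ b′) x (trans (cong (t ++_) (++-assoc z b′ [ c ])) eq))

  ++≡++⇒IsSuffix : ∀ (t₁ s t₂ u : W) → t₁ ++ s ≡ t₂ ++ u → length s ≤ length u → IsSuffix s u
  ++≡++⇒IsSuffix t₁       s []       u eq _       = t₁ , eq
  ++≡++⇒IsSuffix []       s (c ∷ t₂) u refl |s|≤|u| =
    contradiction (≤-trans (s≤s (length-++-≤ʳ u {t₂})) |s|≤|u|) (<-irrefl refl)
  ++≡++⇒IsSuffix (_ ∷ t₁) s (_ ∷ t₂) u eq |s|≤|u| =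
    ++≡++⇒IsSuffix t₁ s t₂ u (∷-injectiveʳ eq) |s|≤|u|

  palSuffix⇒palPrefix : ∀ {s u : W} → IsPalindrome s → IsPalindrome u → IsSuffix s u → IsPrefix s u
  palSuffix⇒palPrefix {s} {u} s-pal u-pal (t , t++s≡u) = reverse t , (begin
    s ++ reverse t         ≡⟨ cong (_++ reverse t) s-pal ⟨
    reverse s ++ reverse t ≡⟨ reverse-++ t s ⟨
    reverse (t ++ s)       ≡⟨ cong reverse t++s≡u ⟩
    reverse u              ≡⟨ u-pal ⟩
    u                      ∎)
    where open ≡-Reasoning

  palSuffix-≤⇒≡⊎IsFactor : ∀ {s u x : W} {a} → IsPalindrome s → IsPalindrome u →
    IsSuffix s (x ∷ʳ a) → IsSuffix u (x ∷ʳ a) → length s ≤ length u → s ≡ u ⊎ IsFactor s x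
  palSuffix-≤⇒≡⊎IsFactor {s} {u} {x} s-pal u-pal (t₁ , t₁++s≡) (t , t++u≡) |s|≤|u|
    with palSuffix⇒palPrefix s-pal u-pal
           (++≡++⇒IsSuffix t₁ s t u (trans t₁++s≡ (sym t++u≡)) |s|≤|u|)
  ... | r , s++r≡u with reverseView r
  ... | []           = inj₁ (trans (sym (++-identityʳ s)) s++r≡u)
  ... | r′ ∶ _ ∶ʳ c =
    inj₂ (t , r′ , ++-∷ʳ-injectiveˡ t (s ++ r′) x
                     (trans (cong (t ++_) (trans (++-assoc s r′ [ c ]) s++r≡u)) t++u≡))

  new-palSuffix-≤⇒≡ : ∀ {z u x : W} {a} → IsPalindrome z → IsSuffix z (x ∷ʳ a) → z ∉ palFactors x →
    IsPalindrome u → IsSuffix u (x ∷ʳ a) → length z ≤ length u → z ≡ u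
  new-palSuffix-≤⇒≡ z-pal z-suf z∉ u-pal u-suf |z|≤|u|
    with palSuffix-≤⇒≡⊎IsFactor z-pal u-pal z-suf u-suf |z|≤|u|
  ... | inj₁ z≡u   = z≡u
  ... | inj₂ z-fac = contradiction (∈-palFactors⁺ z-pal z-fac) z∉

  new-palFactor⇒palSuffix : ∀ (x : W) {a z} → z ∈ palFactors (x ∷ʳ a) → z ∉ palFactors x →
    IsPalindrome z × IsSuffix z (x ∷ʳ a)
  new-palFactor⇒palSuffix x z∈ z∉ with ∈-palFactors⁻ (x ∷ʳ _) z∈
  ... | z-pal , z-fac with IsFactor-∷ʳ⁻ z-fac
  ... | inj₁ z-fac-x = contradiction (∈-palFactors⁺ z-pal z-fac-x) z∉
  ... | inj₂ z-suf   = z-pal , z-suf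

  new-palFactor-unique : ∀ (x : W) {a z z′} → z ∈ palFactors (x ∷ʳ a) → z ∉ palFactors x →
    z′ ∈ palFactors (x ∷ʳ a) → z′ ∉ palFactors x → z ≡ z′
  new-palFactor-unique x {z = z} {z′} z∈ z∉ z′∈ z′∉
    with new-palFactor⇒palSuffix x z∈ z∉ | new-palFactor⇒palSuffix x z′∈ z′∉
  ... | z-pal , z-suf | z′-pal , z′-suf with ≤-total (length z) (length z′)
  ... | inj₁ |z|≤|z′| = new-palSuffix-≤⇒≡ z-pal z-suf z∉ z′-pal z′-suf |z|≤|z′|
  ... | inj₂ |z′|≤|z| = sym (new-palSuffix-≤⇒≡ z′-pal z′-suf z′∉ z-pal z-suf |z′|≤|z|)

  length-palFactors-∷ʳ : ∀ (x : W) a → length (palFactors (x ∷ʳ a)) ≤ suc (length (palFactors x))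
  length-palFactors-∷ʳ x a with any? (λ z → ¬? (z ∈? palFactors x)) (palFactors (x ∷ʳ a))
  ... | no none = ≤-trans (Unique-length-≤ (palFactors-Unique (x ∷ʳ a)) old) (n≤1+n _)
    where
      old : palFactors (x ∷ʳ a) ⊆ palFactors x
      old {z} z∈ = decidable-stable (z ∈? palFactors x) (λ z∉ → none (lose z∈ z∉))
  ... | yes some with find some
  ... | z , z∈ , z∉ = Unique-length-≤ (palFactors-Unique (x ∷ʳ a)) ⊆z∷old
    where
      ⊆z∷old : palFactors (x ∷ʳ a) ⊆ z ∷ palFactors x
      ⊆z∷old {z′} z′∈ with z′ ∈? palFactors x
      ... | yes z′∈old = there z′∈old
      ... | no  z′∉old = here (new-palFactor-unique x z′∈ z′∉old z∈ z∉)

  length-palFactors-++ : ∀ (x s : W) → length (palFactors (x ++ s)) ≤ length (palFactors x) + length s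
  length-palFactors-++ x []      = ≤-reflexive (begin
    length (palFactors (x ++ []))    ≡⟨ cong (λ y → length (palFactors y)) (++-identityʳ x) ⟩
    length (palFactors x)            ≡⟨ +-identityʳ _ ⟨
    length (palFactors x) + 0        ∎)
    where open ≡-Reasoning
  length-palFactors-++ x (c ∷ s) = begin
    length (palFactors (x ++ c ∷ s))        ≡⟨ cong (λ y → length (palFactors y)) (∷ʳ-++ x c s) ⟨
    length (palFactors (x ∷ʳ c ++ s))       ≤⟨ length-palFactors-++ (x ∷ʳ c) s ⟩
    length (palFactors (x ∷ʳ c)) + length s ≤⟨ +-monoˡ-≤ (length s) (length-palFactors-∷ʳ x c) ⟩
    suc (length (palFactors x)) + length s  ≡⟨ +-suc _ (length s) ⟨
    length (palFactors x) + suc (length s)  ∎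
    where open ≤-Reasoning

  length-palFactors : ∀ (w : W) → length (palFactors w) ≤ suc (length w)
  length-palFactors = length-palFactors-++ []

  Rich-++⁻ˡ : ∀ (v u : W) → Rich (v ++ u) → Rich v
  Rich-++⁻ˡ v u rich = ≤-antisym (length-palFactors v) (+-cancelʳ-≤ (length u) _ _ (begin
    suc (length v) + length u           ≡⟨ cong suc (length-++ v) ⟨
    suc (length (v ++ u))               ≡⟨ rich ⟨
    length (palFactors (v ++ u))        ≤⟨ length-palFactors-++ v u ⟩
    length (palFactors v) + length u    ∎))
    where open ≤-Reasoning

  Rich-∷ʳ⇒¬IsFactor-LPS : ∀ {x : W} {a u} → Rich (x ∷ʳ a) → IsLPS u (x ∷ʳ a) → ¬ IsFactor u x
  Rich-∷ʳ⇒¬IsFactor-LPS {x} {a} {u} rich (u-pal , u-suf , u-longest) u-fac =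
    <-irrefl refl (begin-strict
    suc (length x)               <⟨ n<1+n _ ⟩
    suc (suc (length x))         ≡⟨ cong suc (trans (+-comm 1 (length x)) (sym (length-++ x))) ⟩
    suc (length (x ∷ʳ a))        ≡⟨ rich ⟨
    length (palFactors (x ∷ʳ a)) ≤⟨ Unique-length-≤ (palFactors-Unique (x ∷ʳ a)) old ⟩
    length (palFactors x)        ≤⟨ length-palFactors x ⟩
    suc (length x)               ∎)
    where
      open ≤-Reasoning
      old : palFactors (x ∷ʳ a) ⊆ palFactors x
      old {z} z∈ with z ∈? palFactors x
      ... | yes z∈old = z∈old
      ... | no  z∉old with new-palFactor⇒palSuffix x z∈ z∉old
      ... | z-pal , z-suf =
        subst (_∈ palFactors x)
              (sym (new-palSuffix-≤⇒≡ z-pal z-suf z∉old u-pal u-suf (u-longest z z-pal z-suf)))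
              (∈-palFactors⁺ u-pal u-fac)

  Rich⇒LPS-unioccurrent : ∀ (v : W) {u} → Rich (v ++ u) → u ≢ [] → IsLPS u (v ++ u) → ¬ IsFactor u v
  Rich⇒LPS-unioccurrent v {u} rich u≢[] lps with reverseView u
  ... | []           = contradiction refl u≢[]
  ... | u₀ ∶ _ ∶ʳ a = λ u-fac →
    Rich-∷ʳ⇒¬IsFactor-LPS (subst Rich v++u≡ rich) (subst (IsLPS (u₀ ∷ʳ a)) v++u≡ lps)
                          (IsFactor-++ʳ u₀ u-fac)
    where
      v++u≡ : v ++ u₀ ∷ʳ a ≡ (v ++ u₀) ∷ʳ a
      v++u≡ = sym (++-assoc v u₀ [ a ])

  UPS-IsFactor : ∀ {v : W} {us z} → UPS v us → z ∈ us → IsFactor z v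
  UPS-IsFactor (ups-∷ {v} {u} _ _ _)    (here refl) = v , [] , cong (v ++_) (++-identityʳ u)
  UPS-IsFactor (ups-∷ {u = u} _ _ rest) (there z∈)  = IsFactor-++ʳ u (UPS-IsFactor rest z∈)

  UPS-Unique : ∀ {w : W} {ws} → Rich w → UPS w ws → Unique ws
  UPS-Unique rich ups-[] = []
  UPS-Unique rich (ups-∷ {v} {u} {us} u≢[] lps rest) =
    All.tabulate u≢ ∷ UPS-Unique (Rich-++⁻ˡ v u rich) rest
    where
      u≢ : ∀ {u′} → u′ ∈ us → u ≢ u′
      u≢ u′∈ refl = Rich⇒LPS-unioccurrent v rich u≢[] lps (UPS-IsFactor rest u′∈)

  UPS-sum-length : ∀ {w : W} {ws} → UPS w ws → sum (map length ws) ≡ length w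
  UPS-sum-length ups-[] = refl
  UPS-sum-length (ups-∷ {v} {u} {us} _ _ rest) = begin
    length u + sum (map length us) ≡⟨ cong (length u +_) (UPS-sum-length rest) ⟩
    length u + length v            ≡⟨ +-comm (length u) (length v) ⟩
    length v + length u            ≡⟨ length-++ v ⟨
    length (v ++ u)                ∎
    where open ≡-Reasoning

  UPS-length-≤ : ∀ {w : W} {ws} → UPS w ws → length ws ≤ length w
  UPS-length-≤ ups-[] = z≤n
  UPS-length-≤ (ups-∷ {u = []} u≢[] _ _) = contradiction refl u≢[]
  UPS-length-≤ (ups-∷ {v} {c ∷ u} {us} _ _ rest) = begin
    suc (length us)           ≤⟨ s≤s (UPS-length-≤ rest) ⟩
    suc (length v)            ≤⟨ s≤s (length-++-≤ˡ v) ⟩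
    suc (length (v ++ u))     ≡⟨ length-++-sucʳ v c u ⟨
    length (v ++ c ∷ u)       ∎
    where open ≤-Reasoning

-- Counting distinct words

length-cartesianProductWith : ∀ {A B C : Set} (f : A → B → C) xs ys →
  length (cartesianProductWith f xs ys) ≡ length xs * length ys
length-cartesianProductWith f []       ys = refl
length-cartesianProductWith f (x ∷ xs) ys = begin
  length (map (f x) ys ++ cartesianProductWith f xs ys)
    ≡⟨ length-++ (map (f x) ys) ⟩
  length (map (f x) ys) + length (cartesianProductWith f xs ys)
    ≡⟨ cong₂ _+_ (length-map (f x) ys) (length-cartesianProductWith f xs ys) ⟩
  length ys + length xs * length ys
    ∎
  where open ≡-Reasoning

module _ {q : ℕ} where

  wordsUpTo : ℕ → List (Word q)
  wordsUpTo zero    = [ [] ]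
  wordsUpTo (suc ℓ) = [] ∷ cartesianProductWith _∷_ (allFin q) (wordsUpTo ℓ)

  length-wordsUpTo : ∀ ℓ → length (wordsUpTo ℓ) ≤ suc q ^ ℓ
  length-wordsUpTo zero    = ≤-refl
  length-wordsUpTo (suc ℓ) = begin
    suc (length (cartesianProductWith _∷_ (allFin q) (wordsUpTo ℓ)))
      ≡⟨ cong suc (length-cartesianProductWith _∷_ (allFin q) (wordsUpTo ℓ)) ⟩
    suc (length (allFin q) * length (wordsUpTo ℓ))
      ≡⟨ cong (λ k → suc (k * length (wordsUpTo ℓ))) (length-tabulate {n = q} (λ i → i)) ⟩
    suc (q * length (wordsUpTo ℓ))
      ≤⟨ +-mono-≤ (m^n>0 (suc q) ℓ) (*-monoʳ-≤ q (length-wordsUpTo ℓ)) ⟩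
    suc q ^ ℓ + q * suc q ^ ℓ
      ∎
    where open ≤-Reasoning

  ∈-wordsUpTo : ∀ {ℓ} (w : Word q) → length w ≤ ℓ → w ∈ wordsUpTo ℓ
  ∈-wordsUpTo {zero}  []      _         = here refl
  ∈-wordsUpTo {suc ℓ} []      _         = here refl
  ∈-wordsUpTo {suc ℓ} (a ∷ w) (s≤s |w|≤ℓ) =
    there (cartesianProductWith⁺ _∷_ (cong₂ _∷_) (∈-allFin a) (∈-wordsUpTo w |w|≤ℓ))

  Unique-words-length-≤ : ∀ {ℓ} {ws : List (Word q)} → Unique ws →
                          All (λ w → length w ≤ ℓ) ws → length ws ≤ suc q ^ ℓ
  Unique-words-length-≤ {ℓ} ws! short =
    ≤-trans (Unique-length-≤ ws! (λ {w} w∈ → ∈-wordsUpTo w (All.lookup short w∈)))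
            (length-wordsUpTo ℓ)

  Unique-words-!-≤ : ∀ p (ws : List (Word q)) → length ws ≡ p → Unique ws →
                     p ! ≤ suc q ^ sum (map length ws)
  Unique-words-!-≤ zero    ws _   _   = m^n>0 (suc q) (sum (map length ws))
  Unique-words-!-≤ (suc p) ws |ws| ws! with longest-split length ws ws≢[]
    where
      ws≢[] : ws ≢ []
      ws≢[] refl = 0≢1+n |ws|
  ... | m , xs , ys , refl , shorter = begin
    suc p * p !
      ≤⟨ *-mono-≤ (≤-trans (≤-reflexive (sym |ws|)) (Unique-words-length-≤ ws! shorter))
                    (Unique-words-!-≤ p (xs ++ ys) |xs++ys| (Unique-delete xs ws!)) ⟩
    suc q ^ length m * suc q ^ sum (map length (xs ++ ys))
      ≡⟨ ^-distribˡ-+-* (suc q) (length m) _ ⟨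
    suc q ^ (length m + sum (map length (xs ++ ys)))
      ≡⟨ cong (suc q ^_) (sum-map-++-∷ length xs m ys) ⟨
    suc q ^ sum (map length (xs ++ m ∷ ys))
      ∎
    where
      open ≤-Reasoning
      |xs++ys| : length (xs ++ ys) ≡ p
      |xs++ys| = suc-injective (trans (sym (length-++-sucʳ xs m ys)) |ws|)

[1+m]^[1+p]≤m^[1+p]+[1+p]*[1+m]^p : ∀ m p → suc m ^ suc p ≤ m ^ suc p + suc p * suc m ^ p
[1+m]^[1+p]≤m^[1+p]+[1+p]*[1+m]^p m zero    = ≤-reflexive (base m)
  where
    base : ∀ m → suc m * 1 ≡ m * 1 + 1 * 1
    base = solve-∀
[1+m]^[1+p]≤m^[1+p]+[1+p]*[1+m]^p m (suc p) = begin
  suc m * suc m ^ suc p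
    ≤⟨ *-monoʳ-≤ (suc m) ([1+m]^[1+p]≤m^[1+p]+[1+p]*[1+m]^p m p) ⟩
  suc m * (m ^ suc p + suc p * suc m ^ p)
    ≡⟨ expand m (m ^ suc p) p (suc m ^ p) ⟩
  m * m ^ suc p + m ^ suc p + suc p * (suc m * suc m ^ p)
    ≤⟨ +-monoˡ-≤ _ (+-monoʳ-≤ (m * m ^ suc p) (^-monoˡ-≤ (suc p) (n≤1+n m))) ⟩
  m * m ^ suc p + suc m ^ suc p + suc p * suc m ^ suc p
    ≡⟨ collect (m * m ^ suc p) p (suc m ^ suc p) ⟩
  m * m ^ suc p + suc (suc p) * suc m ^ suc p
    ∎
  where
    open ≤-Reasoning
    expand : ∀ m X p Y → suc m * (X + suc p * Y) ≡ m * X + X + suc p * (suc m * Y)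
    expand = solve-∀
    collect : ∀ A p Y → A + Y + suc p * Y ≡ A + suc (suc p) * Y
    collect = solve-∀

-- m^p ≤ (m+1)⋯(m+p) = p!·C(m+p,p); the induction runs along Pascal's rule, with C(m+p,p)
-- replaced by its bound 2^(m+p).
m^p≤p!*2^[m+p] : ∀ m p → m ^ p ≤ p ! * 2 ^ (m + p)
m^p≤p!*2^[m+p] zero    zero    = ≤-refl
m^p≤p!*2^[m+p] zero    (suc p) = z≤n
m^p≤p!*2^[m+p] (suc m) zero    = ≤-trans (m^n>0 2 (suc m + 0)) (≤-reflexive (sym (*-identityˡ _)))
m^p≤p!*2^[m+p] (suc m) (suc p) = begin
  suc m ^ suc p
    ≤⟨ [1+m]^[1+p]≤m^[1+p]+[1+p]*[1+m]^p m p ⟩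
  m ^ suc p + suc p * suc m ^ p
    ≤⟨ +-mono-≤ (m^p≤p!*2^[m+p] m (suc p)) (*-monoʳ-≤ (suc p) (m^p≤p!*2^[m+p] (suc m) p)) ⟩
  suc p ! * 2 ^ (m + suc p) + suc p * (p ! * 2 ^ (suc m + p))
    ≡⟨ cong (λ k → suc p ! * 2 ^ k + suc p * (p ! * 2 ^ (suc m + p))) (+-suc m p) ⟩
  suc p * p ! * 2 ^ (suc m + p) + suc p * (p ! * 2 ^ (suc m + p))
    ≡⟨ double p (p !) (2 ^ (suc m + p)) ⟩
  suc p ! * (2 * 2 ^ (suc m + p))
    ≡⟨ cong (λ k → suc p ! * 2 ^ k) (+-suc (suc m) p) ⟨
  suc p ! * 2 ^ (suc m + suc p)
    ∎
  where
    open ≤-Reasoning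
    double : ∀ p F T → suc p * F * T + suc p * (F * T) ≡ suc p * F * (2 * T)
    double = solve-∀

n<3^n : ∀ n → n < 3 ^ n
n<3^n zero    = s≤s z≤n
n<3^n (suc n) = begin-strict
  suc n           <⟨ s≤s (n<3^n n) ⟩
  suc (3 ^ n)     ≡⟨ +-comm 1 (3 ^ n) ⟩
  3 ^ n + 1       ≤⟨ +-monoʳ-≤ (3 ^ n) (≤-trans (m^n>0 3 n) (m≤m+n (3 ^ n) _)) ⟩
  3 ^ n + (3 ^ n + (3 ^ n + 0)) ∎
  where open ≤-Reasoning

n^p≤3^[[2+q]*n] : ∀ q n p → p ≤ n → p ! ≤ suc q ^ n → n ^ p ≤ 3 ^ ((2 + q) * n)
n^p≤3^[[2+q]*n] q n p p≤n p!≤ = begin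
  n ^ p                       ≤⟨ m^p≤p!*2^[m+p] n p ⟩
  p ! * 2 ^ (n + p)           ≤⟨ *-mono-≤ p!≤ 2^[n+p]≤3^[n+n] ⟩
  suc q ^ n * 3 ^ (n + n)     ≤⟨ *-monoˡ-≤ (3 ^ (n + n)) (^-monoˡ-≤ n (n<3^n q)) ⟩
  (3 ^ q) ^ n * 3 ^ (n + n)   ≡⟨ cong (_* 3 ^ (n + n)) (^-*-assoc 3 q n) ⟩
  3 ^ (q * n) * 3 ^ (n + n)   ≡⟨ ^-distribˡ-+-* 3 (q * n) (n + n) ⟨
  3 ^ (q * n + (n + n))       ≡⟨ cong (3 ^_) (trans (+-comm (q * n) (n + n)) (+-assoc n n (q * n))) ⟩
  3 ^ ((2 + q) * n)           ∎
  where
    open ≤-Reasoning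
    2^[n+p]≤3^[n+n] : 2 ^ (n + p) ≤ 3 ^ (n + n)
    2^[n+p]≤3^[n+n] = ≤-trans (^-monoʳ-≤ 2 (+-monoʳ-≤ n p≤n)) (^-monoˡ-≤ (n + n) (s≤s (s≤s z≤n)))

-- The hypotheses q ≥ 2 and n ≥ 2 only serve to make n / ln n meaningful; the bound holds without them.
theorem1 : (q : ℕ) → 2 ≤ q →
    ∃[ c ] (1 ≤ c × (∀ (w : Word q) → Rich w → 2 ≤ length w →
    ∀ (ws : List (Word q)) → UPS w ws →
    length w ^ length ws ≤ 3 ^ (c * length w)))
theorem1 q _ = 2 + q , s≤s z≤n , bound
  where
    bound : ∀ (w : Word q) → Rich w → 2 ≤ length w → ∀ ws → UPS w ws →
            length w ^ length ws ≤ 3 ^ ((2 + q) * length w)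
    bound w rich _ ws ups = n^p≤3^[[2+q]*n] q (length w) (length ws) (UPS-length-≤ ups) p!≤[1+q]^n
      where
        p!≤[1+q]^n : length ws ! ≤ suc q ^ length w
        p!≤[1+q]^n = subst (λ n → length ws ! ≤ suc q ^ n) (UPS-sum-length ups)
                       (Unique-words-!-≤ (length ws) ws refl (UPS-Unique rich ups))
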